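{- For integers $m\ge 0$ and $0\le i\le m$, let \[ d_i(m)=2^{ -2m}\sum_{k=i}^{m}2^k\binom{2m-2k}{m-k}\binom{m+k}{k}\binom{k}{i}. \] Then for every integer $m\ge 2$ and every $i$ with $0\le i\le m-2$, \[ \frac{d_i(m)}{d_{i+1}(m)}<\frac{(4m+2i+3)\,d_{i+1}(m)}{(4m+2i+7)\,d_{i+2}(m)}. \]
   Context: $d_i(m)$ is the coefficient of $x^i$ in the Boros–Moll polynomial $P_m(x)=\sum_{j,k}\binom{2m+1}{2j}\binom{m-j}{k}\binom{2k+2j}{k+j}\frac{(x+1)^j(x-1)^k}{2^{3(k+j)}}$; these coefficients are positive for $0\le i\le m$. -}

module Defs where

open import Data.Nat as ℕ using (ℕ; zero; suc; _+_; _*_; _∸_; _^_)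
open import Data.Nat.Combinatorics using (_C_)
open import Data.List using (List; map; upTo)
open import Data.Nat.ListAction using (sum)
open import Data.Integer using (+_)
open import Data.Rational as ℚ using (ℚ; _/_; _÷_; 0ℚ)
open import Data.Rational.Properties using (_≟_)
open import Relation.Nullary using (yes; no)
open import Data.Nat.Properties using (m^n≢0)

-- numerator sum  Σ_{k=i}^{m} 2^k C(2m-2k, m-k) C(m+k, k) C(k, i)
-- (range k = i .. m realised as k = i + j, j = 0 .. m-i)
dsum : ℕ → ℕ → ℕ
dsum m i = sum (map (λ j → let k = i + j in
                 (2 ^ k) * (((2 * m) ∸ (2 * k)) C (m ∸ k)) * ((m + k) C k) * (k C i))
               (upTo (suc (m ∸ i))))

d : ℕ → ℕ → ℚ
d m i = _/_ (+ dsum m i) (2 ^ (2 * m)) ⦃ m^n≢0 2 (2 * m) ⦄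

-- division in ℚ, made total (value 0 when the divisor is 0; never used then,
-- since all d_i(m) with 0 ≤ i ≤ m are positive)
_div_ : ℚ → ℚ → ℚ
p div q with q ≟ 0ℚ
... | yes _ = 0ℚ
... | no q≢0 = (p ÷ q) ⦃ ℚ.≢-nonZero q≢0 ⦄

module Submission where

-- Write 2^{2m} d_i(m) = dnum m i = Σ_{k ≤ m} w(m,k) C(k,i), where
-- w(m,k) = 2^k C(2m-2k, m-k) C(m+k, k).  The proof has four layers.
--  * Binomial facts (absorption, a first-order relation in the lower index, central
--    coefficients) give the ratio w(m,k+1)/w(m,k); by summation by parts this yields
--    the three-term recurrence in i
--      (i+1)(i+2) d_{i+2} + (m+i+1)(m-i) d_i = (i+1)(2m+1) d_{i+1}.
--  * A downward induction on i, starting from d_{m+1} = 0, turns the recurrence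
--    into the bound (j+1)(2m+1) d_{j+1} ≤ 2m(m-j) d_j for j < m.
--  * Eliminating d_i with the recurrence, the claim (4m+2i+7) d_i d_{i+2} <
--    (4m+2i+3) d_{i+1}² becomes positivity of a binary quadratic form in
--    (d_{i+1}, d_{i+2}) on the cone cut out by the bound at j = i+1; two explicit
--    polynomial identities in i and m-i-2 supply the positivity.
--  * Finally the natural-number inequality is transported to the rational quotients
--    of the statement by cross-multiplication.

open import Data.Nat hiding (_/_)
open import Data.Nat.Properties
open import Data.Nat.Combinatorics
  using (_C_; nCk+nC[k+1]≡[n+1]C[k+1]; nCk≡nC[n∸k]; k>n⇒nCk≡0; nC1≡n)
open import Data.Nat.Tactic.RingSolver using (solve-∀)
open import Data.Nat.ListAction using (sum)
open import Data.Nat.ListAction.Properties using (sum-++)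
open import Data.List using (map; upTo; _++_; [_])
open import Data.List.Properties using (map-++; applyUpTo-∷ʳ)
open import Data.Product using (∃-syntax; _,_; proj₁; proj₂)
open import Function using (id)
open import Relation.Binary.PropositionalEquality hiding ([_])
open import Relation.Nullary using (yes; no; contradiction)
import Data.Integer as ℤ
import Data.Integer.Properties as ℤP
open import Data.Rational as ℚ using (_/_; 0ℚ; 1ℚ; 1/_; Positive; toℚᵘ)
  renaming (_<_ to _<ℚ_; _*_ to _*ℚ_)
import Data.Rational.Properties as ℚP
import Data.Rational.Unnormalised as ℚᵘ
import Data.Rational.Unnormalised.Properties as ℚᵘP
open import Defs

pascal : ∀ n k → suc n C suc k ≡ n C k + n C suc k
pascal n k = sym (nCk+nC[k+1]≡[n+1]C[k+1] n k)

C-pos : ∀ {n k} → k ≤ n → 0 < n C k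
C-pos {k = zero} _ = z<s
C-pos {suc n} {suc k} (s≤s k≤n) rewrite pascal n k = <-≤-trans (C-pos k≤n) (m≤m+n _ _)

C-absorb : ∀ n k → suc k * (suc n C suc k) ≡ suc n * (n C k)
C-absorb zero zero = refl
C-absorb zero (suc k) = *-zeroʳ (suc (suc k))
C-absorb (suc n) zero = trans (*-identityˡ _) (trans (nC1≡n (suc (suc n))) (sym (*-identityʳ _)))
C-absorb (suc n) (suc k) = begin
  suc (suc k) * (suc (suc n) C suc (suc k))     ≡⟨ cong (suc (suc k) *_) (pascal (suc n) (suc k)) ⟩
  suc (suc k) * (X + Y)                         ≡⟨ split X Y k ⟩
  X + (suc k * X + suc (suc k) * Y)             ≡⟨ cong₂ (λ a b → X + (a + b)) (C-absorb n k) (C-absorb n (suc k)) ⟩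
  X + (suc n * (n C k) + suc n * (n C suc k))   ≡⟨ cong (X +_) (sym (*-distribˡ-+ (suc n) (n C k) (n C suc k))) ⟩
  X + suc n * (n C k + n C suc k)               ≡⟨ cong (λ a → X + suc n * a) (sym (pascal n k)) ⟩
  suc (suc n) * X                               ∎
  where
  open ≡-Reasoning
  X = suc n C suc k
  Y = suc n C suc (suc k)
  split : ∀ x y k → suc (suc k) * (x + y) ≡ x + (suc k * x + suc (suc k) * y)
  split = solve-∀

C-step : ∀ k j → suc j * (k C suc j) + j * (k C j) ≡ k * (k C j)
C-step zero zero = refl
C-step zero (suc j) = cong₂ _+_ (*-zeroʳ (suc (suc j))) (*-zeroʳ (suc j))
C-step (suc k) zero = trans (+-identityʳ _) (C-absorb k 0)
C-step (suc k) (suc j) = begin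
  suc (suc j) * (suc k C suc (suc j)) + suc j * (suc k C suc j)
    ≡⟨ cong₂ _+_ (C-absorb k (suc j)) (C-absorb k j) ⟩
  suc k * (k C suc j) + suc k * (k C j)   ≡⟨ sym (*-distribˡ-+ (suc k) (k C suc j) (k C j)) ⟩
  suc k * (k C suc j + k C j)             ≡⟨ cong (suc k *_) (+-comm (k C suc j) (k C j)) ⟩
  suc k * (k C j + k C suc j)             ≡⟨ cong (suc k *_) (sym (pascal k j)) ⟩
  suc k * (suc k C suc j)                 ∎
  where open ≡-Reasoning

-- Central coefficients:  (n+1) C(2n+2,n+1) = 2(2n+1) C(2n,n).  Absorb twice, using
-- the symmetry C(2n+1,n) = C(2n+1,n+1) in between, and cancel a factor n+1.
C-central : ∀ n → suc n * (2 * suc n C suc n) ≡ 2 * (2 * n + 1) * (2 * n C n)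
C-central n = *-cancelˡ-≡ _ _ (suc n) (begin
  suc n * (suc n * (2 * suc n C suc n))      ≡⟨ cong (λ a → suc n * (suc n * (a C suc n))) (two-suc n) ⟩
  suc n * (suc n * (suc (suc N) C suc n))    ≡⟨ cong (suc n *_) (C-absorb (suc N) n) ⟩
  suc n * (suc (suc N) * (suc N C n))        ≡⟨ cong (λ a → suc n * (suc (suc N) * a)) middle-symmetry ⟩
  suc n * (suc (suc N) * (suc N C suc n))    ≡⟨ swap (suc n) (suc (suc N)) (suc N C suc n) ⟩
  suc (suc N) * (suc n * (suc N C suc n))    ≡⟨ cong (suc (suc N) *_) (C-absorb N n) ⟩
  suc (suc N) * (suc N * (N C n))            ≡⟨ regroup n (N C n) ⟩
  suc n * (2 * (2 * n + 1) * (N C n))        ∎)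
  where
  open ≡-Reasoning
  N = 2 * n
  two-suc : ∀ n → 2 * suc n ≡ suc (suc (2 * n))
  two-suc = solve-∀
  odd : ∀ n → suc (2 * n) ≡ n + suc n
  odd = solve-∀
  middle-symmetry : suc N C n ≡ suc N C suc n
  middle-symmetry = trans (nCk≡nC[n∸k] (≤-trans (m≤m+n n _) (n≤1+n N)))
    (cong (suc N C_) (trans (cong (_∸ n) (odd n)) (m+n∸m≡n n (suc n))))
  swap : ∀ a b c → a * (b * c) ≡ b * (a * c)
  swap = solve-∀
  regroup : ∀ n b → suc (suc (2 * n)) * (suc (2 * n) * b) ≡ suc n * (2 * (2 * n + 1) * b)
  regroup = solve-∀

sumTo : (ℕ → ℕ) → ℕ → ℕ
sumTo f zero = f 0
sumTo f (suc n) = sumTo f n + f (suc n)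

sumTo-cong : ∀ {f g} n → (∀ k → k ≤ n → f k ≡ g k) → sumTo f n ≡ sumTo g n
sumTo-cong zero f≗g = f≗g 0 z≤n
sumTo-cong (suc n) f≗g =
  cong₂ _+_ (sumTo-cong n (λ k k≤n → f≗g k (m≤n⇒m≤1+n k≤n))) (f≗g (suc n) ≤-refl)

sumTo-zero : ∀ f n → (∀ k → k ≤ n → f k ≡ 0) → sumTo f n ≡ 0
sumTo-zero f zero f≗0 = f≗0 0 z≤n
sumTo-zero f (suc n) f≗0 =
  cong₂ _+_ (sumTo-zero f n (λ k k≤n → f≗0 k (m≤n⇒m≤1+n k≤n))) (f≗0 (suc n) ≤-refl)

sumTo-weighted : ∀ (w f e : ℕ → ℕ) a n →
  sumTo (λ k → w k * (a * f k + e k)) n ≡ a * sumTo (λ k → w k * f k) n + sumTo (λ k → w k * e k) n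
sumTo-weighted w f e a zero = distribute (w 0) a (f 0) (e 0)
  where
  distribute : ∀ w a f e → w * (a * f + e) ≡ a * (w * f) + w * e
  distribute = solve-∀
sumTo-weighted w f e a (suc n) = begin
  sumTo W n + w (suc n) * (a * f (suc n) + e (suc n))
    ≡⟨ cong (_+ w (suc n) * (a * f (suc n) + e (suc n))) (sumTo-weighted w f e a n) ⟩
  a * sumTo (λ k → w k * f k) n + sumTo (λ k → w k * e k) n + w (suc n) * (a * f (suc n) + e (suc n))
    ≡⟨ distribute a (sumTo (λ k → w k * f k) n) (sumTo (λ k → w k * e k) n) (w (suc n)) (f (suc n)) (e (suc n)) ⟩
  a * (sumTo (λ k → w k * f k) n + w (suc n) * f (suc n)) + (sumTo (λ k → w k * e k) n + w (suc n) * e (suc n)) ∎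
  where
  open ≡-Reasoning
  W = λ k → w k * (a * f k + e k)
  distribute : ∀ a F E w f e → a * F + E + w * (a * f + e) ≡ a * (F + w * f) + (E + w * e)
  distribute = solve-∀

sumTo-shift : ∀ f n → sumTo f (suc n) ≡ f 0 + sumTo (λ k → f (suc k)) n
sumTo-shift f zero = refl
sumTo-shift f (suc n) = trans (cong (_+ f (suc (suc n))) (sumTo-shift f n)) (+-assoc (f 0) _ _)

sumTo-last : ∀ f n → f n ≤ sumTo f n
sumTo-last f zero = ≤-refl
sumTo-last f (suc n) = m≤n+m (f (suc n)) (sumTo f n)

sumTo-telescope : ∀ f g n → f 0 ≡ 0 → g n ≡ 0 → (∀ k → k < n → f (suc k) ≡ g k) →
  sumTo f n ≡ sumTo g n
sumTo-telescope f g zero f0≡0 gn≡0 _ = trans f0≡0 (sym gn≡0)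
sumTo-telescope f g (suc n) f0≡0 gn≡0 shift = begin
  sumTo f (suc n)                         ≡⟨ sumTo-shift f n ⟩
  f 0 + sumTo (λ k → f (suc k)) n         ≡⟨ cong (_+ sumTo (λ k → f (suc k)) n) f0≡0 ⟩
  sumTo (λ k → f (suc k)) n               ≡⟨ sumTo-cong n (λ k k≤n → shift k (s≤s k≤n)) ⟩
  sumTo g n                               ≡⟨ sym (+-identityʳ _) ⟩
  sumTo g n + 0                           ≡⟨ cong (sumTo g n +_) (sym gn≡0) ⟩
  sumTo g (suc n)                         ∎
  where open ≡-Reasoning

sum-upTo : ∀ f n → sum (map f (upTo (suc n))) ≡ sumTo f n
sum-upTo f zero = +-identityʳ (f 0)
sum-upTo f (suc n) = begin
  sum (map f (upTo (suc (suc n))))          ≡⟨ cong (λ l → sum (map f l)) (sym (applyUpTo-∷ʳ id (suc n))) ⟩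
  sum (map f (upTo (suc n) ++ [ suc n ]))   ≡⟨ cong sum (map-++ f (upTo (suc n)) [ suc n ]) ⟩
  sum (map f (upTo (suc n)) ++ [ f (suc n) ]) ≡⟨ sum-++ (map f (upTo (suc n))) [ f (suc n) ] ⟩
  sum (map f (upTo (suc n))) + (f (suc n) + 0) ≡⟨ cong₂ _+_ (sum-upTo f n) (+-identityʳ (f (suc n))) ⟩
  sumTo f (suc n)                           ∎
  where open ≡-Reasoning

sumTo-from : ∀ f {i n} → i ≤ n → (∀ k → k < i → f k ≡ 0) →
  sumTo (λ j → f (i + j)) (n ∸ i) ≡ sumTo f n
sumTo-from f {zero} _ _ = refl
sumTo-from f {suc i} {suc n} (s≤s i≤n) f<i≡0 = begin
  sumTo (λ j → f (suc i + j)) (n ∸ i)   ≡⟨ sumTo-from (λ k → f (suc k)) i≤n (λ k k<i → f<i≡0 (suc k) (s≤s k<i)) ⟩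
  sumTo (λ k → f (suc k)) n             ≡⟨ cong (_+ sumTo (λ k → f (suc k)) n) (sym (f<i≡0 0 z<s)) ⟩
  f 0 + sumTo (λ k → f (suc k)) n       ≡⟨ sym (sumTo-shift f n) ⟩
  sumTo f (suc n)                       ∎
  where open ≡-Reasoning

-- w(m,k) = 2^k C(2m-2k, m-k) C(m+k, k), so that 2^{2m} d_i(m) = Σ_k w(m,k) C(k,i).
weight : ℕ → ℕ → ℕ
weight m k = 2 ^ k * ((2 * m ∸ 2 * k) C (m ∸ k)) * ((m + k) C k)

-- dnum m i = 2^{2m} d_i(m), summing over all k ≤ m (the terms with k < i vanish).
dnum : ℕ → ℕ → ℕ
dnum m i = sumTo (λ k → weight m k * (k C i)) m

dsum≡dnum : ∀ m i → i ≤ m → dsum m i ≡ dnum m i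
dsum≡dnum m i i≤m = trans (sum-upTo _ (m ∸ i))
  (sumTo-from (λ k → weight m k * (k C i)) i≤m
              (λ k k<i → trans (cong (weight m k *_) (k>n⇒nCk≡0 k<i)) (*-zeroʳ (weight m k))))

-- Every weight is positive (also for k > m, where the truncated m ∸ k is 0).
weight-pos : ∀ m k → 0 < weight m k
weight-pos m k = *-mono-< (*-mono-< (m^n>0 2 k) (C-pos half≤double)) (C-pos (m≤n+m k m))
  where
  half≤double : m ∸ k ≤ 2 * m ∸ 2 * k
  half≤double = subst (m ∸ k ≤_) (*-distribˡ-∸ 2 m k) (m≤m+n (m ∸ k) _)

weight-ratio-core : ∀ m k n →
  2 ^ suc k * (2 * n C n) * (suc (m + k) C suc k) * (suc k * suc (2 * n)) ≡
  2 ^ k * (2 * suc n C suc n) * ((m + k) C k) * (suc n * suc (m + k))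
weight-ratio-core m k n = begin
  2 ^ suc k * (2 * n C n) * X * (suc k * suc (2 * n))   ≡⟨ regroup (2 ^ k) (2 * n C n) X k n ⟩
  2 ^ k * (2 * (2 * n + 1) * (2 * n C n)) * (suc k * X)  ≡⟨ cong₂ (λ a b → 2 ^ k * a * b) (sym (C-central n)) (C-absorb (m + k) k) ⟩
  2 ^ k * (suc n * (2 * suc n C suc n)) * (suc (m + k) * ((m + k) C k))
    ≡⟨ regroup′ (2 ^ k) (2 * suc n C suc n) ((m + k) C k) n (m + k) ⟩
  2 ^ k * (2 * suc n C suc n) * ((m + k) C k) * (suc n * suc (m + k)) ∎
  where
  open ≡-Reasoning
  X = suc (m + k) C suc k
  regroup : ∀ P c x k n → 2 * P * c * x * (suc k * suc (2 * n)) ≡ P * (2 * (2 * n + 1) * c) * (suc k * x)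
  regroup = solve-∀
  regroup′ : ∀ P c′ y n s → P * (suc n * c′) * (suc s * y) ≡ P * c′ * y * (suc n * suc s)
  regroup′ = solve-∀

weight-ratio-gap : ∀ k n → let m = suc k + n in
  weight m (suc k) * (suc k * suc (2 * (m ∸ suc k))) ≡ weight m k * ((m ∸ k) * suc (m + k))
weight-ratio-gap k n = begin
  weight m (suc k) * (suc k * suc (2 * (m ∸ suc k)))
    ≡⟨ cong₂ (λ a b → 2 ^ suc k * (a C b) * ((m + suc k) C suc k) * (suc k * suc (2 * b))) 2m∸2[k+1] m∸[k+1] ⟩
  2 ^ suc k * (2 * n C n) * ((m + suc k) C suc k) * (suc k * suc (2 * n))
    ≡⟨ cong (λ a → 2 ^ suc k * (2 * n C n) * (a C suc k) * (suc k * suc (2 * n))) (+-suc m k) ⟩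
  2 ^ suc k * (2 * n C n) * (suc (m + k) C suc k) * (suc k * suc (2 * n))
    ≡⟨ weight-ratio-core m k n ⟩
  2 ^ k * (2 * suc n C suc n) * ((m + k) C k) * (suc n * suc (m + k))
    ≡⟨ sym (cong₂ (λ a b → 2 ^ k * (a C b) * ((m + k) C k) * (b * suc (m + k))) 2m∸2k m∸k) ⟩
  weight m k * ((m ∸ k) * suc (m + k)) ∎
  where
  open ≡-Reasoning
  m = suc k + n
  m∸[k+1] : m ∸ suc k ≡ n
  m∸[k+1] = m+n∸m≡n (suc k) n
  2m∸2[k+1] : 2 * m ∸ 2 * suc k ≡ 2 * n
  2m∸2[k+1] = trans (cong (_∸ 2 * suc k) (*-distribˡ-+ 2 (suc k) n)) (m+n∸m≡n (2 * suc k) (2 * n))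
  m≡k+[n+1] : m ≡ k + suc n
  m≡k+[n+1] = sym (+-suc k n)
  m∸k : m ∸ k ≡ suc n
  m∸k = trans (cong (_∸ k) m≡k+[n+1]) (m+n∸m≡n k (suc n))
  2m∸2k : 2 * m ∸ 2 * k ≡ 2 * suc n
  2m∸2k = trans (cong (λ a → 2 * a ∸ 2 * k) m≡k+[n+1])
    (trans (cong (_∸ 2 * k) (*-distribˡ-+ 2 k (suc n))) (m+n∸m≡n (2 * k) (2 * suc n)))

weight-ratio : ∀ m k → k < m →
  weight m (suc k) * (suc k * suc (2 * (m ∸ suc k))) ≡ weight m k * ((m ∸ k) * suc (m + k))
weight-ratio m k k<m with m≤n⇒∃[o]m+o≡n k<m
... | n , refl = weight-ratio-gap k n

weight-telescope : ∀ m (h : ℕ → ℕ) →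
  sumTo (λ k → weight m k * (k * suc (2 * (m ∸ k)) * h (k ∸ 1))) m ≡
  sumTo (λ k → weight m k * ((m ∸ k) * suc (m + k) * h k)) m
weight-telescope m h = sumTo-telescope _ _ m (*-zeroʳ (weight m 0)) top shift
  where
  top : weight m m * ((m ∸ m) * suc (m + m) * h m) ≡ 0
  top = trans (cong (λ a → weight m m * (a * suc (m + m) * h m)) (n∸n≡0 m)) (*-zeroʳ (weight m m))
  shift : ∀ k → k < m →
    weight m (suc k) * (suc k * suc (2 * (m ∸ suc k)) * h k) ≡ weight m k * ((m ∸ k) * suc (m + k) * h k)
  shift k k<m = begin
    weight m (suc k) * (suc k * suc (2 * (m ∸ suc k)) * h k)   ≡⟨ sym (*-assoc (weight m (suc k)) _ (h k)) ⟩
    weight m (suc k) * (suc k * suc (2 * (m ∸ suc k))) * h k   ≡⟨ cong (_* h k) (weight-ratio m k k<m) ⟩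
    weight m k * ((m ∸ k) * suc (m + k)) * h k                 ≡⟨ *-assoc (weight m k) _ (h k) ⟩
    weight m k * ((m ∸ k) * suc (m + k) * h k)                 ∎
    where open ≡-Reasoning

-- The linear algebra behind the pointwise identity below, for k = I+s and m = k+t,
-- given the three binomial relations h₁ h₂ h₃ among b₀ = C(k,I), b₁ = C(k,I+1),
-- b₂ = C(k,I+2), b′ = C(k-1,I).  Both sides plus (I+1)² b₁ reduce to Φ·b₀.
pointwise-algebra : ∀ I s t b₀ b₁ b₂ b′ → let k = I + s ; m = k + t in
  suc I * b₁ ≡ s * b₀ →
  suc (suc I) * b₂ + suc I * b₁ ≡ k * b₁ →
  k * b′ ≡ suc I * b₁ →
  suc I * suc (suc I) * b₂ + ((m + suc I) * (s + t) * b₀ + k * suc (2 * t) * b′)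
    ≡ suc I * suc (2 * m) * b₁ + t * suc (m + k) * b₀
pointwise-algebra I s t b₀ b₁ b₂ b′ h₁ h₂ h₃ = +-cancelʳ-≡ extra _ _ (trans left (sym right))
  where
  open ≡-Reasoning
  k = I + s
  m = k + t
  extra = suc I * (suc I * b₁)
  Q = (m + suc I) * (s + t) * b₀
  Φ = (k + suc (2 * t)) * s + (m + suc I) * (s + t)
  gather : ∀ I s t b₀ b₁ b₂ b′ →
    suc I * suc (suc I) * b₂ + ((I + s + t + suc I) * (s + t) * b₀ + (I + s) * suc (2 * t) * b′) + suc I * (suc I * b₁)
    ≡ suc I * (suc (suc I) * b₂ + suc I * b₁) + (I + s + t + suc I) * (s + t) * b₀ + suc (2 * t) * ((I + s) * b′)
  gather = solve-∀
  collect : ∀ I s t b₁ Q → suc I * ((I + s) * b₁) + Q + suc (2 * t) * (suc I * b₁) ≡ (I + s + suc (2 * t)) * (suc I * b₁) + Q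
  collect = solve-∀
  factor : ∀ I s t b₀ → (I + s + suc (2 * t)) * (s * b₀) + (I + s + t + suc I) * (s + t) * b₀
    ≡ ((I + s + suc (2 * t)) * s + (I + s + t + suc I) * (s + t)) * b₀
  factor = solve-∀
  collect′ : ∀ I s t b₀ b₁ → suc I * suc (2 * (I + s + t)) * b₁ + t * suc (I + s + t + (I + s)) * b₀ + suc I * (suc I * b₁)
    ≡ (suc (2 * (I + s + t)) + suc I) * (suc I * b₁) + t * suc (I + s + t + (I + s)) * b₀
  collect′ = solve-∀
  factor′ : ∀ I s t b₀ → (suc (2 * (I + s + t)) + suc I) * (s * b₀) + t * suc (I + s + t + (I + s)) * b₀
    ≡ ((I + s + suc (2 * t)) * s + (I + s + t + suc I) * (s + t)) * b₀
  factor′ = solve-∀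
  left : suc I * suc (suc I) * b₂ + (Q + k * suc (2 * t) * b′) + extra ≡ Φ * b₀
  left = begin
    suc I * suc (suc I) * b₂ + (Q + k * suc (2 * t) * b′) + extra
      ≡⟨ gather I s t b₀ b₁ b₂ b′ ⟩
    suc I * (suc (suc I) * b₂ + suc I * b₁) + Q + suc (2 * t) * (k * b′)
      ≡⟨ cong₂ (λ a b → suc I * a + Q + suc (2 * t) * b) h₂ h₃ ⟩
    suc I * (k * b₁) + Q + suc (2 * t) * (suc I * b₁)
      ≡⟨ collect I s t b₁ Q ⟩
    (k + suc (2 * t)) * (suc I * b₁) + Q
      ≡⟨ cong (λ a → (k + suc (2 * t)) * a + Q) h₁ ⟩
    (k + suc (2 * t)) * (s * b₀) + Q
      ≡⟨ factor I s t b₀ ⟩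
    Φ * b₀ ∎
  right : suc I * suc (2 * m) * b₁ + t * suc (m + k) * b₀ + extra ≡ Φ * b₀
  right = begin
    suc I * suc (2 * m) * b₁ + t * suc (m + k) * b₀ + extra
      ≡⟨ collect′ I s t b₀ b₁ ⟩
    (suc (2 * m) + suc I) * (suc I * b₁) + t * suc (m + k) * b₀
      ≡⟨ cong (λ a → (suc (2 * m) + suc I) * a + t * suc (m + k) * b₀) h₁ ⟩
    (suc (2 * m) + suc I) * (s * b₀) + t * suc (m + k) * b₀
      ≡⟨ factor′ I s t b₀ ⟩
    Φ * b₀ ∎

C-absorb-pred : ∀ I k → k * ((k ∸ 1) C I) ≡ suc I * (k C suc I)
C-absorb-pred I zero = sym (*-zeroʳ (suc I))
C-absorb-pred I (suc k) = sym (C-absorb k I)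

-- The pointwise identity whose w(m,k)-weighted sum over k ≤ m is the recurrence:
-- the leftover terms k(2(m-k)+1)C(k-1,I) and (m-k)(m+k+1)C(k,I) telescope.
pointwise : ∀ m I k → k ≤ m →
  suc I * suc (suc I) * (k C suc (suc I)) + ((m + suc I) * (m ∸ I) * (k C I) + k * suc (2 * (m ∸ k)) * ((k ∸ 1) C I))
    ≡ suc I * suc (2 * m) * (k C suc I) + (m ∸ k) * suc (m + k) * (k C I)
pointwise m I k k≤m with k <? I
... | yes k<I
  rewrite k>n⇒nCk≡0 k<I | k>n⇒nCk≡0 (m<n⇒m<1+n k<I) | k>n⇒nCk≡0 (m<n⇒m<1+n (m<n⇒m<1+n k<I))
        | k>n⇒nCk≡0 (≤-<-trans (m∸n≤m k 1) k<I)
  = all-zero (suc I * suc (suc I)) ((m + suc I) * (m ∸ I)) (k * suc (2 * (m ∸ k)))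
             (suc I * suc (2 * m)) ((m ∸ k) * suc (m + k))
  where
  all-zero : ∀ a b c d e → a * 0 + (b * 0 + c * 0) ≡ d * 0 + e * 0
  all-zero = solve-∀
... | no k≮I with m≤n⇒∃[o]m+o≡n (≮⇒≥ k≮I)
...   | s , refl with m≤n⇒∃[o]m+o≡n k≤m
...     | t , refl
  rewrite m+n∸m≡n (I + s) t | trans (cong (_∸ I) (+-assoc I s t)) (m+n∸m≡n I (s + t))
  = pointwise-algebra I s t (k C I) (k C suc I) (k C suc (suc I)) ((k ∸ 1) C I) h₁ h₂ (C-absorb-pred I k)
  where
  h₂ : suc (suc I) * (k C suc (suc I)) + suc I * (k C suc I) ≡ k * (k C suc I)
  h₂ = C-step k (suc I)
  h₁ : suc I * (k C suc I) ≡ s * (k C I)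
  h₁ = +-cancelʳ-≡ (I * (k C I)) _ _
    (trans (C-step k I) (trans (*-distribʳ-+ (k C I) I s) (+-comm (I * (k C I)) (s * (k C I)))))

recurrence : ∀ m I →
  suc I * suc (suc I) * dnum m (suc (suc I)) + (m + suc I) * (m ∸ I) * dnum m I
    ≡ suc I * suc (2 * m) * dnum m (suc I)
recurrence m I = +-cancelʳ-≡ X _ _ (begin
  a₂ * dnum m (suc (suc I)) + a₀ * dnum m I + X     ≡⟨ +-assoc (a₂ * dnum m (suc (suc I))) _ X ⟩
  a₂ * dnum m (suc (suc I)) + (a₀ * dnum m I + X)   ≡⟨ cong (a₂ * dnum m (suc (suc I)) +_) (sym (sumTo-weighted w (_C I) left a₀ m)) ⟩
  a₂ * dnum m (suc (suc I)) + sumTo (λ k → w k * (a₀ * (k C I) + left k)) m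
    ≡⟨ sym (sumTo-weighted w (_C suc (suc I)) (λ k → a₀ * (k C I) + left k) a₂ m) ⟩
  sumTo (λ k → w k * (a₂ * (k C suc (suc I)) + (a₀ * (k C I) + left k))) m
    ≡⟨ sumTo-cong m (λ k k≤m → cong (w k *_) (pointwise m I k k≤m)) ⟩
  sumTo (λ k → w k * (a₁ * (k C suc I) + right k)) m
    ≡⟨ sumTo-weighted w (_C suc I) right a₁ m ⟩
  a₁ * dnum m (suc I) + sumTo (λ k → w k * right k) m
    ≡⟨ cong (a₁ * dnum m (suc I) +_) (sym (weight-telescope m (_C I))) ⟩
  a₁ * dnum m (suc I) + X ∎)
  where
  open ≡-Reasoning
  w = weight m
  a₀ = (m + suc I) * (m ∸ I)
  a₁ = suc I * suc (2 * m)
  a₂ = suc I * suc (suc I)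
  left = λ k → k * suc (2 * (m ∸ k)) * ((k ∸ 1) C I)
  right = λ k → (m ∸ k) * suc (m + k) * (k C I)
  X = sumTo (λ k → w k * left k) m

-- d_i(m) > 0 for i ≤ m: already the term k = m is positive.
dnum-pos : ∀ {m i} → i ≤ m → 0 < dnum m i
dnum-pos {m} {i} i≤m =
  <-≤-trans (*-mono-< (weight-pos m m) (C-pos i≤m)) (sumTo-last (λ k → weight m k * (k C i)) m)

-- d_{m+1}(m) = 0, the starting point of the downward induction.
dnum-top : ∀ m → dnum m (suc m) ≡ 0
dnum-top m = sumTo-zero _ m
  (λ k k≤m → trans (cong (weight m k *_) (k>n⇒nCk≡0 (s≤s k≤m))) (*-zeroʳ (weight m k)))

recurrence-gap : ∀ I s → let m = I + s in
  suc I * suc (suc I) * dnum m (suc (suc I)) + (m + suc I) * s * dnum m I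
    ≡ suc I * suc (2 * m) * dnum m (suc I)
recurrence-gap I s =
  subst (λ g → suc I * suc (suc I) * dnum m (suc (suc I)) + (m + suc I) * g * dnum m I
                 ≡ suc I * suc (2 * m) * dnum m (suc I))
        (m+n∸m≡n I s) (recurrence m I)
  where m = I + s

-- Multiplying the goal by
-- K = (2m+1)(m+j+1) and eliminating x, it reduces to
-- (2m+1)²(m+j+1) + 4m²(t+1) ≤ 2m(2m+1)², which holds with slack (4m+1)(t+1).
lower-bound-step : ∀ j t {x y z} → let m = j + suc (suc t) in
  suc j * suc (suc j) * z + (m + suc j) * suc (suc t) * x ≡ suc j * suc (2 * m) * y →
  suc (suc j) * suc (2 * m) * z ≤ 2 * m * suc t * y →
  suc j * suc (2 * m) * y ≤ 2 * m * suc (suc t) * x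
lower-bound-step j t {x} {y} {z} rec bound-next =
  *-cancelˡ-≤ K (+-cancelʳ-≤ W _ _ (begin
    K * GL + W                   ≤⟨ +-monoˡ-≤ W (m≤m+n (K * GL) slack) ⟩
    K * GL + slack + W           ≡⟨ expand j t y ⟩
    2 * m * suc (2 * m) * GL     ≡⟨ cong (2 * m * suc (2 * m) *_) (sym rec) ⟩
    2 * m * suc (2 * m) * (suc j * suc (suc j) * z + (m + suc j) * suc (suc t) * x)
                                 ≡⟨ split j t x z ⟩
    2 * m * suc j * (suc (suc j) * suc (2 * m) * z) + K * (2 * m * suc (suc t) * x)
                                 ≤⟨ +-monoˡ-≤ _ (*-monoʳ-≤ (2 * m * suc j) bound-next) ⟩
    W + K * (2 * m * suc (suc t) * x)  ≡⟨ +-comm W _ ⟩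
    K * (2 * m * suc (suc t) * x) + W  ∎))
  where
  open ≤-Reasoning
  m = j + suc (suc t)
  K = suc (2 * m) * (suc j + m)
  GL = suc j * suc (2 * m) * y
  W = 2 * m * suc j * (2 * m * suc t * y)
  slack = (4 * m + 1) * suc t * suc j * y
  expand : ∀ j t y →
    suc (2 * (j + suc (suc t))) * (suc j + (j + suc (suc t))) * (suc j * suc (2 * (j + suc (suc t))) * y)
      + (4 * (j + suc (suc t)) + 1) * suc t * suc j * y
      + 2 * (j + suc (suc t)) * suc j * (2 * (j + suc (suc t)) * suc t * y)
    ≡ 2 * (j + suc (suc t)) * suc (2 * (j + suc (suc t))) * (suc j * suc (2 * (j + suc (suc t))) * y)
  expand = solve-∀
  split : ∀ j t x z →
    2 * (j + suc (suc t)) * suc (2 * (j + suc (suc t)))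
      * (suc j * suc (suc j) * z + (j + suc (suc t) + suc j) * suc (suc t) * x)
    ≡ 2 * (j + suc (suc t)) * suc j * (suc (suc j) * suc (2 * (j + suc (suc t))) * z)
      + suc (2 * (j + suc (suc t))) * (suc j + (j + suc (suc t))) * (2 * (j + suc (suc t)) * suc (suc t) * x)
  split = solve-∀

-- The lower bound (j+1)(2m+1) d_{j+1} ≤ 2m(m-j) d_j for j < m, with m - j = t+1,
-- by downward induction on j (upward in t), starting from d_{m+1}(m) = 0.
lower-bound : ∀ m j t → j + suc t ≡ m →
  suc j * suc (2 * m) * dnum m (suc j) ≤ 2 * m * suc t * dnum m j
lower-bound .(j + 1) j zero refl = ≤-reflexive (begin
  suc j * suc (2 * m) * dnum m (suc j)
    ≡⟨ sym (recurrence-gap j 1) ⟩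
  suc j * suc (suc j) * dnum m (suc (suc j)) + (m + suc j) * 1 * dnum m j
    ≡⟨ cong (λ a → suc j * suc (suc j) * a + (m + suc j) * 1 * dnum m j) top ⟩
  suc j * suc (suc j) * 0 + (m + suc j) * 1 * dnum m j
    ≡⟨ tidy j (dnum m j) ⟩
  2 * m * 1 * dnum m j ∎)
  where
  open ≡-Reasoning
  m = j + 1
  top : dnum m (suc (suc j)) ≡ 0
  top = trans (cong (λ a → dnum m (suc a)) (+-comm 1 j)) (dnum-top m)
  tidy : ∀ j d → suc j * suc (suc j) * 0 + (j + 1 + suc j) * 1 * d ≡ 2 * (j + 1) * 1 * d
  tidy = solve-∀
lower-bound .(j + suc (suc t)) j (suc t) refl =
  lower-bound-step j t (recurrence-gap j (suc (suc t)))
    (lower-bound (j + suc (suc t)) (suc j) t (sym (+-suc j (suc t))))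

-- For p, q with p z ≤ q y and z > 0, the quadratic form a y² - b y z + c z² is
-- positive provided q b p < a p² + c q² and q b ≤ 2 a p: substituting q y = p z + w,
--   q²(a y² + c z²) = q² b y z + (D₁ z² + D₂ z w + a w²)
-- with D₁ = a p² + c q² - q b p > 0 and D₂ = 2 a p - q b.
quadratic-bound : ∀ a b c p q {y z} →
  q * b * p < a * p * p + c * q * q → q * b ≤ 2 * a * p → p * z ≤ q * y → 0 < z →
  b * y * z < a * y * y + c * z * z
quadratic-bound a b c p q {y} {z} gap₁ gap₂ cone z>0
  with m≤n⇒∃[o]m+o≡n gap₁ | m≤n⇒∃[o]m+o≡n gap₂ | m≤n⇒∃[o]m+o≡n cone
... | d₁ , e₁ | d₂ , e₂ | w , e₃ = *-cancelˡ-< (q * q) _ _ (begin-strict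
  q * q * (b * y * z)                                      <⟨ m<m+n _ R>0 ⟩
  q * q * (b * y * z) + R                                  ≡⟨ cong (_+ R) (reorder b q y z) ⟩
  q * b * z * (q * y) + R                                  ≡⟨ cong (λ u → q * b * z * u + R) (sym e₃) ⟩
  q * b * z * (p * z + w) + R                              ≡⟨ expand a b p q z w (suc d₁) d₂ ⟩
  (q * b * p + suc d₁) * z * z + (q * b + d₂) * z * w + a * w * w
    ≡⟨ cong₂ (λ u v → u * z * z + v * z * w + a * w * w) (trans (+-suc (q * b * p) d₁) e₁) e₂ ⟩
  (a * p * p + c * q * q) * z * z + 2 * a * p * z * w + a * w * w
                                                           ≡⟨ square a c p q z w ⟩
  a * (p * z + w) * (p * z + w) + c * q * q * z * z        ≡⟨ cong (λ u → a * u * u + c * q * q * z * z) e₃ ⟩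
  a * (q * y) * (q * y) + c * q * q * z * z                ≡⟨ unfold a c q y z ⟩
  q * q * (a * y * y + c * z * z) ∎)
  where
  open ≤-Reasoning
  R = suc d₁ * z * z + d₂ * z * w + a * w * w
  R>0 : 0 < R
  R>0 = <-≤-trans (*-mono-< (*-mono-< (z<s {d₁}) z>0) z>0) (≤-trans (m≤m+n _ _) (m≤m+n _ _))
  reorder : ∀ b q y z → q * q * (b * y * z) ≡ q * b * z * (q * y)
  reorder = solve-∀
  expand : ∀ a b p q z w D₁ D₂ → q * b * z * (p * z + w) + (D₁ * z * z + D₂ * z * w + a * w * w)
    ≡ (q * b * p + D₁) * z * z + (q * b + D₂) * z * w + a * w * w
  expand = solve-∀
  square : ∀ a c p q z w → (a * p * p + c * q * q) * z * z + 2 * a * p * z * w + a * w * w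
    ≡ a * (p * z + w) * (p * z + w) + c * q * q * z * z
  square = solve-∀
  unfold : ∀ a c q y z → a * (q * y) * (q * y) + c * q * q * z * z ≡ q * q * (a * y * y + c * z * z)
  unfold = solve-∀

-- Eliminating x with a linear relation α z + a x = β y: the inequality
-- K x z < K′ y² follows from K β y z < K′ a y² + K α z² (both sides are the
-- target scaled by a, plus K α z²).
eliminate : ∀ a K K′ α β {x y z} → α * z + a * x ≡ β * y →
  K * β * y * z < K′ * a * y * y + K * α * z * z → K * x * z < K′ * y * y
eliminate a K K′ α β {x} {y} {z} relation form =
  *-cancelˡ-< a _ _ (+-cancelˡ-< (K * α * z * z) _ _ (begin-strict
    K * α * z * z + a * (K * x * z)     ≡⟨ factor a K α x z ⟩
    K * z * (α * z + a * x)             ≡⟨ cong (K * z *_) relation ⟩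
    K * z * (β * y)                     ≡⟨ reorder K β y z ⟩
    K * β * y * z                       <⟨ form ⟩
    K′ * a * y * y + K * α * z * z      ≡⟨ reorder′ a K K′ α y z ⟩
    K * α * z * z + a * (K′ * y * y)    ∎))
  where
  open ≤-Reasoning
  factor : ∀ a K α x z → K * α * z * z + a * (K * x * z) ≡ K * z * (α * z + a * x)
  factor = solve-∀
  reorder : ∀ K β y z → K * z * (β * y) ≡ K * β * y * z
  reorder = solve-∀
  reorder′ : ∀ a K K′ α y z → K′ * a * y * y + K * α * z * z ≡ K * α * z * z + a * (K′ * y * y)
  reorder′ = solve-∀

-- The two coefficient conditions of quadratic-bound for the form arising below,
-- with m = i+t+2, K = 4m+2i+7, K′ = 4m+2i+3, a = (m+i+1)(t+2), α = (i+1)(i+2),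
-- β = (i+1)(2m+1), p = i+2, q = t+1: each difference is an explicit polynomial
-- in i, t with nonnegative coefficients (and positive constant term for the first).
coefficient-gap₁ : ∀ i t →
  suc t * ((4 * (i + suc (suc t)) + 2 * i + 7) * (suc i * suc (2 * (i + suc (suc t))))) * suc (suc i)
    + (144 + (134 * t + 54 * t * t + 8 * t * t * t + 296 * i + 179 * i * t + 47 * i * t * t
             + 4 * i * t * t * t + 236 * i * i + 80 * i * i * t + 10 * i * i * t * t
             + 86 * i * i * i + 12 * i * i * i * t + 12 * i * i * i * i))
  ≡ (4 * (i + suc (suc t)) + 2 * i + 3) * ((i + suc (suc t) + suc i) * suc (suc t)) * suc (suc i) * suc (suc i)
    + (4 * (i + suc (suc t)) + 2 * i + 7) * (suc i * suc (suc i)) * suc t * suc t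
coefficient-gap₁ = solve-∀

coefficient-gap₂ : ∀ i t →
  suc t * ((4 * (i + suc (suc t)) + 2 * i + 7) * (suc i * suc (2 * (i + suc (suc t)))))
    + (189 + (191 * t + 66 * t * t + 8 * t * t * t + 317 * i + 225 * i * t + 40 * i * t * t
             + 184 * i * i + 92 * i * i * t + 8 * i * i * t * t + 36 * i * i * i + 12 * i * i * i * t))
  ≡ 2 * ((4 * (i + suc (suc t)) + 2 * i + 3) * ((i + suc (suc t) + suc i) * suc (suc t))) * suc (suc i)
coefficient-gap₂ = solve-∀

drop-factor : ∀ a b c {y z} → a * suc c * z ≤ c * b * y → a * z ≤ b * y
drop-factor a b c {y} {z} bound = *-cancelˡ-≤ (suc c) (begin
  suc c * (a * z)   ≡⟨ reorder a c z ⟩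
  a * suc c * z     ≤⟨ bound ⟩
  c * b * y         ≤⟨ *-monoˡ-≤ y (*-monoˡ-≤ b (n≤1+n c)) ⟩
  suc c * b * y     ≡⟨ *-assoc (suc c) b y ⟩
  suc c * (b * y)   ∎)
  where
  open ≤-Reasoning
  reorder : ∀ a c z → suc c * (a * z) ≡ a * suc c * z
  reorder = solve-∀

two-below : ∀ i t → suc (suc i) ≤ i + suc (suc t)
two-below i t =
  subst (suc (suc i) ≤_) (sym (trans (+-suc i (suc t)) (cong suc (+-suc i t)))) (s≤s (s≤s (m≤m+n i t)))

-- Eliminate d_i by the recurrence at i; the remaining quadratic form in
-- (d_{i+1}, d_{i+2}) is positive on the cone given by the lower bound at i+1.
ratio-inequality : ∀ i t → let m = i + suc (suc t) in
  (4 * m + 2 * i + 7) * dnum m i * dnum m (suc (suc i))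
    < (4 * m + 2 * i + 3) * dnum m (suc i) * dnum m (suc i)
ratio-inequality i t =
  eliminate a K K′ α β (recurrence-gap i (suc (suc t)))
    (quadratic-bound (K′ * a) (K * β) (K * α) (suc (suc i)) (suc t) gap₁ gap₂ cone (dnum-pos (two-below i t)))
  where
  m = i + suc (suc t)
  K = 4 * m + 2 * i + 7
  K′ = 4 * m + 2 * i + 3
  a = (m + suc i) * suc (suc t)
  α = suc i * suc (suc i)
  β = suc i * suc (2 * m)
  gap₁ : suc t * (K * β) * suc (suc i) < K′ * a * suc (suc i) * suc (suc i) + K * α * suc t * suc t
  gap₁ = <-≤-trans (m<m+n _ z<s) (≤-reflexive (coefficient-gap₁ i t))
  gap₂ : suc t * (K * β) ≤ 2 * (K′ * a) * suc (suc i)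
  gap₂ = ≤-trans (m≤m+n _ _) (≤-reflexive (coefficient-gap₂ i t))
  cone : suc (suc i) * dnum m (suc (suc i)) ≤ suc t * dnum m (suc i)
  cone = drop-factor (suc (suc i)) (suc t) (2 * m) (lower-bound m (suc i) t (sym (+-suc i (suc t))))

div-<-div : ∀ p q r s → Positive q → Positive s → p *ℚ s <ℚ r *ℚ q → (p div q) <ℚ (r div s)
div-<-div p q r s q>0 s>0 cross with q ℚP.≟ 0ℚ | s ℚP.≟ 0ℚ
... | yes q≡0 | _ = contradiction (subst (0ℚ <ℚ_) q≡0 (ℚP.positive⁻¹ q {{q>0}})) (ℚP.<-irrefl refl)
... | no _ | yes s≡0 = contradiction (subst (0ℚ <ℚ_) s≡0 (ℚP.positive⁻¹ s {{s>0}})) (ℚP.<-irrefl refl)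
... | no q≢0 | no s≢0 =
  ℚP.*-cancelʳ-<-nonNeg (q *ℚ s) {{ℚP.pos⇒nonNeg (q *ℚ s) {{ℚP.pos*pos⇒pos q {{q>0}} s {{s>0}}}}}}
    (subst₂ _<ℚ_ (sym (cancel p q s)) (sym (trans (cong (r *ℚ 1/ s *ℚ_) (ℚP.*-comm q s)) (cancel r s q))) cross)
  where
  instance
    q≢0′ = ℚ.≢-nonZero q≢0
    s≢0′ = ℚ.≢-nonZero s≢0
  cancel : ∀ x y z .{{_ : ℚ.NonZero y}} → x *ℚ 1/ y *ℚ (y *ℚ z) ≡ x *ℚ z
  cancel x y z = begin
    x *ℚ 1/ y *ℚ (y *ℚ z)   ≡⟨ ℚP.*-assoc x (1/ y) (y *ℚ z) ⟩
    x *ℚ (1/ y *ℚ (y *ℚ z)) ≡⟨ cong (x *ℚ_) (sym (ℚP.*-assoc (1/ y) y z)) ⟩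
    x *ℚ (1/ y *ℚ y *ℚ z)   ≡⟨ cong (λ u → x *ℚ (u *ℚ z)) (ℚP.*-inverseˡ y) ⟩
    x *ℚ (1ℚ *ℚ z)          ≡⟨ cong (x *ℚ_) (ℚP.*-identityˡ z) ⟩
    x *ℚ z                  ∎
    where open ≡-Reasoning

fraction-< : ∀ N .{{_ : NonZero N}} x y z u v → v * x * z < u * y * y →
  (ℤ.+ x / N) *ℚ ((ℤ.+ v / 1) *ℚ (ℤ.+ z / N)) <ℚ ((ℤ.+ u / 1) *ℚ (ℤ.+ y / N)) *ℚ (ℤ.+ y / N)
fraction-< (suc n) x y z u v vxz<uyy =
  ℚP.toℚᵘ-cancel-< (ℚᵘP.<-respˡ-≃ (ℚᵘP.≃-sym left) (ℚᵘP.<-respʳ-≃ (ℚᵘP.≃-sym right) unnormalised))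
  where
  N = suc n
  frac : ∀ k d → toℚᵘ (ℤ.+ k / suc d) ℚᵘ.≃ ℚᵘ.mkℚᵘ (ℤ.+ k) d
  frac k d = ℚP.toℚᵘ-fromℚᵘ (ℚᵘ.mkℚᵘ (ℤ.+ k) d)
  left : toℚᵘ ((ℤ.+ x / N) *ℚ ((ℤ.+ v / 1) *ℚ (ℤ.+ z / N)))
         ℚᵘ.≃ ℚᵘ.mkℚᵘ (ℤ.+ x) n ℚᵘ.* (ℚᵘ.mkℚᵘ (ℤ.+ v) 0 ℚᵘ.* ℚᵘ.mkℚᵘ (ℤ.+ z) n)
  left = ℚᵘP.≃-trans (ℚP.toℚᵘ-homo-* (ℤ.+ x / N) _)
           (ℚᵘP.*-cong (frac x n) (ℚᵘP.≃-trans (ℚP.toℚᵘ-homo-* (ℤ.+ v / 1) _) (ℚᵘP.*-cong (frac v 0) (frac z n))))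
  right : toℚᵘ (((ℤ.+ u / 1) *ℚ (ℤ.+ y / N)) *ℚ (ℤ.+ y / N))
          ℚᵘ.≃ (ℚᵘ.mkℚᵘ (ℤ.+ u) 0 ℚᵘ.* ℚᵘ.mkℚᵘ (ℤ.+ y) n) ℚᵘ.* ℚᵘ.mkℚᵘ (ℤ.+ y) n
  right = ℚᵘP.≃-trans (ℚP.toℚᵘ-homo-* ((ℤ.+ u / 1) *ℚ (ℤ.+ y / N)) _)
            (ℚᵘP.*-cong (ℚᵘP.≃-trans (ℚP.toℚᵘ-homo-* (ℤ.+ u / 1) _) (ℚᵘP.*-cong (frac u 0) (frac y n))) (frac y n))
  reorder : ∀ x v z N → x * (v * z) * (1 * N * N) ≡ v * x * z * (N * (1 * N))
  reorder = solve-∀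
  cross : x * (v * z) * (1 * N * N) < u * y * y * (N * (1 * N))
  cross = subst (_< u * y * y * (N * (1 * N))) (sym (reorder x v z N)) (*-monoˡ-< (N * (1 * N)) vxz<uyy)
  unnormalised : ℚᵘ.mkℚᵘ (ℤ.+ x) n ℚᵘ.* (ℚᵘ.mkℚᵘ (ℤ.+ v) 0 ℚᵘ.* ℚᵘ.mkℚᵘ (ℤ.+ z) n)
                 ℚᵘ.< (ℚᵘ.mkℚᵘ (ℤ.+ u) 0 ℚᵘ.* ℚᵘ.mkℚᵘ (ℤ.+ y) n) ℚᵘ.* ℚᵘ.mkℚᵘ (ℤ.+ y) n
  unnormalised = ℚᵘ.*<* (subst₂ ℤ._<_
    (trans (ℤP.pos-* (x * (v * z)) (1 * N * N)) (cong (ℤ._* ℤ.+ (1 * N * N)) (trans (ℤP.pos-* x (v * z)) (cong (ℤ.+ x ℤ.*_) (ℤP.pos-* v z)))))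
    (trans (ℤP.pos-* (u * y * y) (N * (1 * N))) (cong (ℤ._* ℤ.+ (N * (1 * N))) (trans (ℤP.pos-* (u * y) y) (cong (ℤ._* ℤ.+ y) (ℤP.pos-* u y)))))
    (ℤ.+<+ cross))

d-pos : ∀ {m k} → k ≤ m → Positive (d m k)
d-pos {m} {k} k≤m = ℚP.normalize-pos (dsum m k) (2 ^ (2 * m)) {{m^n≢0 2 (2 * m)}}
  {{>-nonZero (subst (0 <_) (sym (dsum≡dnum m k k≤m)) (dnum-pos k≤m))}}

split-gap : ∀ {m i} → 2 ≤ m → i ≤ m ∸ 2 → ∃[ t ] i + suc (suc t) ≡ m
split-gap {suc zero} (s≤s ())
split-gap {suc (suc m)} {i} _ i≤m with m≤n⇒∃[o]m+o≡n i≤m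
... | t , refl = t , trans (+-suc i (suc t)) (cong suc (+-suc i t))

dsum-inequality : ∀ i t → let m = i + suc (suc t) in
  (4 * m + 2 * i + 7) * dsum m i * dsum m (i + 2) < (4 * m + 2 * i + 3) * dsum m (i + 1) * dsum m (i + 1)
dsum-inequality i t = subst₂ _<_
    (cong₂ (λ x z → (4 * m + 2 * i + 7) * x * z) (sym (dsum≡dnum m i i≤m)) (sym (shifted 2 i+2≤m)))
    (cong (λ y → (4 * m + 2 * i + 3) * y * y) (sym (shifted 1 i+1≤m)))
    (ratio-inequality i t)
  where
  m = i + suc (suc t)
  i+2≤m = subst (_≤ m) (+-comm 2 i) (two-below i t)
  i+1≤m = ≤-trans (+-monoʳ-≤ i (n≤1+n 1)) i+2≤m
  i≤m = ≤-trans (m≤m+n i 1) i+1≤m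
  shifted : ∀ k → i + k ≤ m → dsum m (i + k) ≡ dnum m (k + i)
  shifted k le = trans (dsum≡dnum m (i + k) le) (cong (dnum m) (+-comm i k))

Claim : ℕ → ℕ → Set
Claim m i = (d m i div d m (i + 1))
  <ℚ (((ℤ.+ (4 * m + 2 * i + 3) / 1) *ℚ d m (i + 1)) div ((ℤ.+ (4 * m + 2 * i + 7) / 1) *ℚ d m (i + 2)))

-- The claim for m = i+t+2: cross-multiply, then compare numerators over 2^{4m}.
claim-gap : ∀ i t → Claim (i + suc (suc t)) i
claim-gap i t =
  div-<-div (d m i) (d m (i + 1)) (ℤ.+ K′ / 1 *ℚ d m (i + 1)) (ℤ.+ K / 1 *ℚ d m (i + 2))
    (d-pos i+1≤m) (ℚP.pos*pos⇒pos (ℤ.+ K / 1) {{K>0}} (d m (i + 2)) {{d-pos i+2≤m}})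
    (fraction-< (2 ^ (2 * m)) {{m^n≢0 2 (2 * m)}} (dsum m i) (dsum m (i + 1)) (dsum m (i + 2)) K′ K
                (dsum-inequality i t))
  where
  m = i + suc (suc t)
  K = 4 * m + 2 * i + 7
  K′ = 4 * m + 2 * i + 3
  i+2≤m = subst (_≤ m) (+-comm 2 i) (two-below i t)
  i+1≤m = ≤-trans (+-monoʳ-≤ i (n≤1+n 1)) i+2≤m
  K>0 : Positive (ℤ.+ K / 1)
  K>0 = ℚP.normalize-pos K 1 {{_}} {{>-nonZero (<-≤-trans z<s (m≤n+m 7 (4 * m + 2 * i)))}}

lemma2p2 : (m i : ℕ) → 2 ≤ m → i ≤ m ∸ 2 →
    (d m i div d m (i + 1))
    <ℚ (((ℤ.+ (4 * m + 2 * i + 3) / 1) *ℚ d m (i + 1))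
    div ((ℤ.+ (4 * m + 2 * i + 7) / 1) *ℚ d m (i + 2)))
lemma2p2 m i 2≤m i≤m∸2 = subst (λ n → Claim n i) (proj₂ gap) (claim-gap i (proj₁ gap))
  where
  gap : ∃[ t ] i + suc (suc t) ≡ m
  gap = split-gap 2≤m i≤m∸2
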